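{- Let $H$ be an $r$-uniform hypergraph with $r\ge 3$, let $E^*$ be an edge of $H$, let $t$ be an integer with $1\le t\le\lfloor\frac{r-1}{2}\rfloor$, and let $H^*_t$ be the $t$-star extension of $H$ at $E^*$. Then $\omega(H^*_t)=\max\{\omega(H),\,r+t\}$.
   Context: An $r$-uniform hypergraph has a finite vertex set and a family of $r$-element vertex subsets called edges. The $t$-star extension $H^*_t$ of $H$ at an edge $E^*$: take a set $W$ of $t$ new vertices (disjoint from $V(H)$); $H^*_t$ has vertex set $V(H)\cup W$ and its edges are all edges of $H$ together with every $r$-subset $K\subseteq E^*\cup W$ with $1\le |K\cap W|\le t$. A clique is a set $S$ of vertices such that every $r$-subset of $S$ is an edge; the clique number $\omega(\cdot)$ is the maximum number of vertices of a clique. -}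

module Defs where

open import Data.Nat using (ℕ; _+_; _≤_)
open import Data.Bool using (true; false)
open import Data.Vec using (_++_; replicate)
open import Data.Fin.Subset using (Subset; _⊆_; _∩_; ∣_∣)
open import Data.Product using (Σ; _×_)
open import Data.Sum using (_⊎_)
open import Relation.Binary.PropositionalEquality using (_≡_)

record Hypergraph : Set₁ where
  field
    n    : ℕ
    Edge : Subset n → Set
open Hypergraph public

Uniform : ℕ → Hypergraph → Set
Uniform r H = ∀ e → Edge H e → ∣ e ∣ ≡ r

IsClique : ℕ → (H : Hypergraph) → Subset (n H) → Set
IsClique r H S = ∀ K → K ⊆ S → ∣ K ∣ ≡ r → Edge H K

IsCliqueNumber : ℕ → Hypergraph → ℕ → Set
IsCliqueNumber r H k =
  Σ (Subset (n H)) (λ S → IsClique r H S × ∣ S ∣ ≡ k)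
  × (∀ S → IsClique r H S → ∣ S ∣ ≤ k)

-- Vertex set Fin (n + t): the old vertices are
-- the first n (inject+), the new set W is the last t (raise n).
-- A subset A of V(H) is embedded as A ++ replicate t false.
W : (n t : ℕ) → Subset (n + t)
W n t = replicate n false ++ replicate t true

starExt : (r : ℕ) (H : Hypergraph) (E* : Subset (n H)) (t : ℕ) → Hypergraph
starExt r H E* t = record
  { n = n H + t
  ; Edge = λ K →
      Σ (Subset (n H)) (λ e → Edge H e × K ≡ e ++ replicate t false)
      ⊎ (K ⊆ (E* ++ replicate t true) × ∣ K ∣ ≡ r
         × 1 ≤ ∣ K ∩ W (n H) t ∣ × ∣ K ∩ W (n H) t ∣ ≤ t)
  }

-- Every clique S of H*_t splits into old vertices A and new vertices B ⊆ W.
-- If B is empty, A is a clique of H, so |S| ≤ ω(H).  If B contains some w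
-- and A some x ∉ E*, then as soon as |S| ≥ r an r-subset of S through x and
-- w is an edge of H*_t containing a new vertex, hence lying inside E* ∪ W,
-- which x does not; so |S| < r.  Otherwise S ⊆ E* ∪ W and |S| ≤ r + t.
-- Conversely S₀ (a maximum clique of H) and E* ∪ W are cliques of H*_t.
module Submission where

open import Defs
open import Data.Nat using (ℕ; _≤_; _+_; _∸_; _⊔_; _/_)
open import Data.Fin.Subset using (Subset)

open import Data.Nat using (zero; suc; z≤n; s≤s; _≤?_)
open import Data.Nat.Properties
  using (≤-reflexive; ≤-trans; ≤-antisym; ≰⇒>; <⇒≤; <⇒≱; n≤1+n; m≤m+n;
         +-mono-≤; +-identityʳ; m≤m⊔n; m≤n⊔m; ⊔-sel; module ≤-Reasoning)
open import Data.Vec using ([]; _∷_; _++_; splitAt; here)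
open import Data.Vec.Properties using (zipWith-++; ++-injectiveˡ; ++-injectiveʳ)
open import Data.Fin.Subset
  using (_⊆_; _∈_; _∩_; ∣_∣; ⊥; ⊤; ⁅_⁆; Nonempty; outside; inside)
open import Data.Fin.Subset.Properties
  using (drop-∷-⊆; out⊆; s⊆s; ⊆-refl; ⊆-antisym; ⊥⊆; ∉⊥;
         p⊆q⇒∣p∣≤∣q∣; ∣p∣≤n; ∣⊥∣≡0; ∣⊤∣≡n; x∈⁅x⁆; x∈⁅y⁆⇒x≡y; ∣⁅x⁆∣≡1;
         ∩-zeroʳ; ∩-identityʳ; Empty-unique; nonempty?)
open import Data.Product using (Σ; ∃; _×_; _,_; proj₁)
open import Data.Sum using (inj₁; inj₂)
open import Relation.Binary.PropositionalEquality
  using (_≡_; refl; sym; trans; cong; cong₂; subst; module ≡-Reasoning)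
open import Relation.Nullary using (yes; no; contradiction)

private variable i j : ℕ

∣p++q∣≡∣p∣+∣q∣ : (p : Subset i) (q : Subset j) → ∣ p ++ q ∣ ≡ ∣ p ∣ + ∣ q ∣
∣p++q∣≡∣p∣+∣q∣ []            q = refl
∣p++q∣≡∣p∣+∣q∣ (outside ∷ p) q = ∣p++q∣≡∣p∣+∣q∣ p q
∣p++q∣≡∣p∣+∣q∣ (inside ∷ p)  q = cong suc (∣p++q∣≡∣p∣+∣q∣ p q)

∣p++⊥∣≡∣p∣ : ∀ {i j} (p : Subset i) → ∣ p ++ ⊥ {j} ∣ ≡ ∣ p ∣
∣p++⊥∣≡∣p∣ {j = j} p = begin
  ∣ p ++ ⊥ {j} ∣      ≡⟨ ∣p++q∣≡∣p∣+∣q∣ p ⊥ ⟩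
  ∣ p ∣ + ∣ ⊥ {j} ∣   ≡⟨ cong (∣ p ∣ +_) (∣⊥∣≡0 j) ⟩
  ∣ p ∣ + 0           ≡⟨ +-identityʳ ∣ p ∣ ⟩
  ∣ p ∣               ∎
  where open ≡-Reasoning

∣p++q∩W∣≡∣q∣ : ∀ {i j} (p : Subset i) (q : Subset j) → ∣ (p ++ q) ∩ W i j ∣ ≡ ∣ q ∣
∣p++q∩W∣≡∣q∣ {i} {j} p q = begin
  ∣ (p ++ q) ∩ W i j ∣      ≡⟨ cong ∣_∣ (zipWith-++ _ p q ⊥ ⊤) ⟩
  ∣ (p ∩ ⊥) ++ (q ∩ ⊤) ∣    ≡⟨ cong₂ (λ a b → ∣ a ++ b ∣) (∩-zeroʳ p) (∩-identityʳ q) ⟩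
  ∣ ⊥ {i} ++ q ∣            ≡⟨ ∣p++q∣≡∣p∣+∣q∣ (⊥ {i}) q ⟩
  ∣ ⊥ {i} ∣ + ∣ q ∣         ≡⟨ cong (_+ ∣ q ∣) (∣⊥∣≡0 i) ⟩
  ∣ q ∣                     ∎
  where open ≡-Reasoning

++⊆++⁺ : {p r : Subset i} {q s : Subset j} → p ⊆ r → q ⊆ s → p ++ q ⊆ r ++ s
++⊆++⁺ {p = []}          {r = []}          _   q⊆s = q⊆s
++⊆++⁺ {p = outside ∷ p} {r = _ ∷ r}       p⊆r q⊆s = out⊆ (++⊆++⁺ (drop-∷-⊆ p⊆r) q⊆s)
++⊆++⁺ {p = inside ∷ p}  {r = inside ∷ r}  p⊆r q⊆s = s⊆s (++⊆++⁺ (drop-∷-⊆ p⊆r) q⊆s)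
++⊆++⁺ {p = inside ∷ p}  {r = outside ∷ r} p⊆r _   with p⊆r here
... | ()

++⊆++⁻ : (p r : Subset i) {q s : Subset j} → p ++ q ⊆ r ++ s → p ⊆ r × q ⊆ s
++⊆++⁻ []            []            pq⊆rs = ⊆-refl , pq⊆rs
++⊆++⁻ (outside ∷ p) (_ ∷ r)       pq⊆rs with ++⊆++⁻ p r (drop-∷-⊆ pq⊆rs)
... | p⊆r , q⊆s = out⊆ p⊆r , q⊆s
++⊆++⁻ (inside ∷ p)  (inside ∷ r)  pq⊆rs with ++⊆++⁻ p r (drop-∷-⊆ pq⊆rs)
... | p⊆r , q⊆s = s⊆s p⊆r , q⊆s
++⊆++⁻ (inside ∷ p)  (outside ∷ r) pq⊆rs with pq⊆rs here
... | ()

x∈p⇒⁅x⁆⊆p : ∀ {x} {p : Subset i} → x ∈ p → ⁅ x ⁆ ⊆ p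
x∈p⇒⁅x⁆⊆p {x = x} x∈p y∈⁅x⁆ = subst (_∈ _) (sym (x∈⁅y⁆⇒x≡y x y∈⁅x⁆)) x∈p

⊆∧∣q∣≤∣p∣⇒≡ : {p q : Subset i} → p ⊆ q → ∣ q ∣ ≤ ∣ p ∣ → p ≡ q
⊆∧∣q∣≤∣p∣⇒≡ {p = []}          {q = []}          _   _         = refl
⊆∧∣q∣≤∣p∣⇒≡ {p = outside ∷ p} {q = outside ∷ q} p⊆q ∣q∣≤∣p∣   =
  cong (outside ∷_) (⊆∧∣q∣≤∣p∣⇒≡ (drop-∷-⊆ p⊆q) ∣q∣≤∣p∣)
⊆∧∣q∣≤∣p∣⇒≡ {p = outside ∷ p} {q = inside ∷ q}  p⊆q ∣q∣<∣p∣   =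
  contradiction ∣q∣<∣p∣ (<⇒≱ (s≤s (p⊆q⇒∣p∣≤∣q∣ (drop-∷-⊆ p⊆q))))
⊆∧∣q∣≤∣p∣⇒≡ {p = inside ∷ p}  {q = inside ∷ q}  p⊆q (s≤s ∣q∣≤∣p∣) =
  cong (inside ∷_) (⊆∧∣q∣≤∣p∣⇒≡ (drop-∷-⊆ p⊆q) ∣q∣≤∣p∣)
⊆∧∣q∣≤∣p∣⇒≡ {p = inside ∷ p}  {q = outside ∷ q} p⊆q _         with p⊆q here
... | ()

nonempty⇒∣p∣≥1 : {p : Subset i} → Nonempty p → 1 ≤ ∣ p ∣
nonempty⇒∣p∣≥1 {p = p} (x , x∈p) = subst (_≤ ∣ p ∣) (∣⁅x⁆∣≡1 x) (p⊆q⇒∣p∣≤∣q∣ (x∈p⇒⁅x⁆⊆p x∈p))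

intermediate-subset : ∀ k (p q : Subset i) → p ⊆ q → ∣ p ∣ ≤ k → k ≤ ∣ q ∣ →
                      ∃ λ s → p ⊆ s × s ⊆ q × ∣ s ∣ ≡ k
intermediate-subset zero    []            []            _   _          z≤n = [] , ⊆-refl , ⊆-refl , refl
intermediate-subset k       (outside ∷ p) (outside ∷ q) p⊆q ∣p∣≤k      k≤∣q∣
  with intermediate-subset k p q (drop-∷-⊆ p⊆q) ∣p∣≤k k≤∣q∣
... | s , p⊆s , s⊆q , ∣s∣≡k = outside ∷ s , s⊆s p⊆s , s⊆s s⊆q , ∣s∣≡k
intermediate-subset (suc k) (inside ∷ p)  (inside ∷ q)  p⊆q (s≤s ∣p∣≤k) (s≤s k≤∣q∣)
  with intermediate-subset k p q (drop-∷-⊆ p⊆q) ∣p∣≤k k≤∣q∣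
... | s , p⊆s , s⊆q , ∣s∣≡k = inside ∷ s , s⊆s p⊆s , s⊆s s⊆q , cong suc ∣s∣≡k
intermediate-subset k       (outside ∷ p) (inside ∷ q)  p⊆q ∣p∣≤k      k≤1+∣q∣ with k ≤? ∣ q ∣
... | yes k≤∣q∣
  with intermediate-subset k p q (drop-∷-⊆ p⊆q) ∣p∣≤k k≤∣q∣
... | s , p⊆s , s⊆q , ∣s∣≡k = outside ∷ s , s⊆s p⊆s , out⊆ s⊆q , ∣s∣≡k
intermediate-subset k       (outside ∷ p) (inside ∷ q)  p⊆q _          k≤1+∣q∣ | no k≰∣q∣ =
  inside ∷ q , p⊆q , ⊆-refl , ≤-antisym (≰⇒> k≰∣q∣) k≤1+∣q∣
intermediate-subset k       (inside ∷ p)  (outside ∷ q) p⊆q _          _ with p⊆q here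
... | ()

HasCliqueOfSize : ℕ → (H : Hypergraph) → ℕ → Set
HasCliqueOfSize r H k = Σ (Subset (n H)) λ S → IsClique r H S × ∣ S ∣ ≡ k

HasCliqueOfSize-⊔ : ∀ {r H a b} → HasCliqueOfSize r H a → HasCliqueOfSize r H b →
                    HasCliqueOfSize r H (a ⊔ b)
HasCliqueOfSize-⊔ {r} {H} {a} {b} clique-a clique-b with ⊔-sel a b
... | inj₁ a⊔b≡a = subst (HasCliqueOfSize r H) (sym a⊔b≡a) clique-a
... | inj₂ a⊔b≡b = subst (HasCliqueOfSize r H) (sym a⊔b≡b) clique-b

module StarExtension (r : ℕ) (H : Hypergraph) (E* : Subset (n H)) (t : ℕ) where

  H* : Hypergraph
  H* = starExt r H E* t

  edge-on-old-vertices : {A : Subset (n H)} → Edge H* (A ++ ⊥) → Edge H A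
  edge-on-old-vertices {A} (inj₁ (e , e∈H , A⊥≡e⊥)) =
    subst (Edge H) (sym (++-injectiveˡ A e A⊥≡e⊥)) e∈H
  edge-on-old-vertices {A} (inj₂ (_ , _ , 1≤∣K∩W∣ , _)) =
    contradiction (≤-reflexive (trans (∣p++q∩W∣≡∣q∣ A ⊥) (∣⊥∣≡0 t))) (<⇒≱ 1≤∣K∩W∣)

  edge-meeting-W-⊆-star : {A : Subset (n H)} {B : Subset t} →
                          Edge H* (A ++ B) → Nonempty B → A ⊆ E*
  edge-meeting-W-⊆-star {A} (inj₁ (e , _ , AB≡e⊥)) (_ , x∈B) =
    contradiction (subst (_ ∈_) (++-injectiveʳ A e AB≡e⊥) x∈B) ∉⊥
  edge-meeting-W-⊆-star {A} (inj₂ (AB⊆E*⊤ , _)) _ = proj₁ (++⊆++⁻ A E* AB⊆E*⊤)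

  clique-restricts-to-old-vertices : {A : Subset (n H)} {B : Subset t} →
                                     IsClique r H* (A ++ B) → IsClique r H A
  clique-restricts-to-old-vertices S-clique K K⊆A ∣K∣≡r =
    edge-on-old-vertices (S-clique (K ++ ⊥) (++⊆++⁺ K⊆A ⊥⊆) (trans (∣p++⊥∣≡∣p∣ K) ∣K∣≡r))

  old-clique-lifts : {S : Subset (n H)} → IsClique r H S → IsClique r H* (S ++ ⊥)
  old-clique-lifts {S} S-clique K K⊆S⊥ ∣K∣≡r with splitAt (n H) K
  ... | A , B , refl with ++⊆++⁻ A S K⊆S⊥
  ... | A⊆S , B⊆⊥ with ⊆-antisym B⊆⊥ ⊥⊆
  ... | refl = inj₁ (A , S-clique A A⊆S (trans (sym (∣p++⊥∣≡∣p∣ A)) ∣K∣≡r) , refl)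

  star-clique : Edge H E* → ∣ E* ∣ ≡ r → IsClique r H* (E* ++ ⊤)
  star-clique E*∈H ∣E*∣≡r K K⊆E*⊤ ∣K∣≡r with splitAt (n H) K
  ... | A , B , refl with nonempty? B
  ... | yes B-nonempty =
    inj₂ (K⊆E*⊤ , ∣K∣≡r , subst (1 ≤_) (sym (∣p++q∩W∣≡∣q∣ A B)) (nonempty⇒∣p∣≥1 B-nonempty)
                        , subst (_≤ t) (sym (∣p++q∩W∣≡∣q∣ A B)) (∣p∣≤n B))
  ... | no B-empty with Empty-unique B-empty
  ... | refl = inj₁ (E* , E*∈H , cong (_++ ⊥) A≡E*)
    where
    A≡E* : A ≡ E*
    A≡E* = ⊆∧∣q∣≤∣p∣⇒≡ (proj₁ (++⊆++⁻ A E* K⊆E*⊤))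
                       (≤-reflexive (trans ∣E*∣≡r (trans (sym ∣K∣≡r) (∣p++⊥∣≡∣p∣ A))))

  large-clique-meeting-W-⊆-star : 2 ≤ r → {A : Subset (n H)} {B : Subset t} →
                                  IsClique r H* (A ++ B) → r ≤ ∣ A ++ B ∣ → Nonempty B → A ⊆ E*
  large-clique-meeting-W-⊆-star 2≤r {A} {B} S-clique r≤∣S∣ (w , w∈B) {x} x∈A
    with intermediate-subset r (⁅ x ⁆ ++ ⁅ w ⁆) (A ++ B)
           (++⊆++⁺ (x∈p⇒⁅x⁆⊆p x∈A) (x∈p⇒⁅x⁆⊆p w∈B)) ∣⁅x⁆++⁅w⁆∣≤r r≤∣S∣
    where
    ∣⁅x⁆++⁅w⁆∣≤r : ∣ ⁅ x ⁆ ++ ⁅ w ⁆ ∣ ≤ r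
    ∣⁅x⁆++⁅w⁆∣≤r = subst (_≤ r)
      (sym (trans (∣p++q∣≡∣p∣+∣q∣ ⁅ x ⁆ ⁅ w ⁆) (cong₂ _+_ (∣⁅x⁆∣≡1 x) (∣⁅x⁆∣≡1 w)))) 2≤r
  ... | K , ⁅x⁆++⁅w⁆⊆K , K⊆S , ∣K∣≡r with splitAt (n H) K
  ... | A′ , B′ , refl with ++⊆++⁻ ⁅ x ⁆ A′ ⁅x⁆++⁅w⁆⊆K
  ... | ⁅x⁆⊆A′ , ⁅w⁆⊆B′ =
    edge-meeting-W-⊆-star (S-clique _ K⊆S ∣K∣≡r) (w , ⁅w⁆⊆B′ (x∈⁅x⁆ w)) (⁅x⁆⊆A′ (x∈⁅x⁆ x))

  clique-size-bound : 2 ≤ r → ∣ E* ∣ ≡ r → ∀ {k} → (∀ S → IsClique r H S → ∣ S ∣ ≤ k) →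
                      ∀ S → IsClique r H* S → ∣ S ∣ ≤ k ⊔ (r + t)
  clique-size-bound 2≤r ∣E*∣≡r {k} ω-bound S S-clique with splitAt (n H) S
  ... | A , B , refl with nonempty? B
  ... | no B-empty with Empty-unique B-empty
  ...   | refl = begin
    ∣ A ++ ⊥ ∣      ≡⟨ ∣p++⊥∣≡∣p∣ A ⟩
    ∣ A ∣           ≤⟨ ω-bound A (clique-restricts-to-old-vertices S-clique) ⟩
    k               ≤⟨ m≤m⊔n k (r + t) ⟩
    k ⊔ (r + t)     ∎
    where open ≤-Reasoning
  clique-size-bound 2≤r ∣E*∣≡r {k} ω-bound _ S-clique | A , B , refl | yes B-nonempty
    with r ≤? ∣ A ++ B ∣
  ... | no r≰∣S∣ = ≤-trans (<⇒≤ (≰⇒> r≰∣S∣)) (≤-trans (m≤m+n r t) (m≤n⊔m k (r + t)))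
  ... | yes r≤∣S∣ = begin
    ∣ A ++ B ∣      ≡⟨ ∣p++q∣≡∣p∣+∣q∣ A B ⟩
    ∣ A ∣ + ∣ B ∣   ≤⟨ +-mono-≤ (p⊆q⇒∣p∣≤∣q∣ A⊆E*) (∣p∣≤n B) ⟩
    ∣ E* ∣ + t      ≡⟨ cong (_+ t) ∣E*∣≡r ⟩
    r + t           ≤⟨ m≤n⊔m k (r + t) ⟩
    k ⊔ (r + t)     ∎
    where
    open ≤-Reasoning
    A⊆E* : A ⊆ E*
    A⊆E* = large-clique-meeting-W-⊆-star 2≤r S-clique r≤∣S∣ B-nonempty

proposition4p3 : (r : ℕ) (H : Hypergraph) → Uniform r H → 3 ≤ r →
                 (E* : Subset (n H)) → Edge H E* →
                 (t : ℕ) → 1 ≤ t → t ≤ (r ∸ 1) / 2 →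
                 (k : ℕ) → IsCliqueNumber r H k →
                 IsCliqueNumber r (starExt r H E* t) (k ⊔ (r + t))
proposition4p3 r H uniform 3≤r E* E*∈H t _ _ k ((S , S-clique , ∣S∣≡k) , ω-bound) =
  HasCliqueOfSize-⊔ (S ++ ⊥ , old-clique-lifts S-clique , trans (∣p++⊥∣≡∣p∣ S) ∣S∣≡k)
                    (E* ++ ⊤ , star-clique E*∈H ∣E*∣≡r , ∣E*++⊤∣≡r+t)
  , clique-size-bound (≤-trans (n≤1+n 2) 3≤r) ∣E*∣≡r ω-bound
  where
  open StarExtension r H E* t
  ∣E*∣≡r : ∣ E* ∣ ≡ r
  ∣E*∣≡r = uniform E* E*∈H
  ∣E*++⊤∣≡r+t : ∣ E* ++ ⊤ ∣ ≡ r + t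
  ∣E*++⊤∣≡r+t = trans (∣p++q∣≡∣p∣+∣q∣ E* ⊤) (cong₂ _+_ ∣E*∣≡r (∣⊤∣≡n t))
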